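{- Let $p$ be a prime, $k\geq 2$ an integer, and $f\in\mathbb{Z}[x]$ not identically zero modulo $p$. Suppose $\zeta_0\in\mathbb{Z}/(p)$ is a root of $\tilde f$ of finite multiplicity $j\geq 2$, and suppose there exists $\zeta\in\mathbb{Z}/(p^k)$ with $\zeta\equiv\zeta_0\pmod p$ and $f(\zeta)\equiv 0\pmod{p^k}$. Then $s(f,\zeta_0)\in\{2,\ldots,j\}$.
   Context: $\tilde f$ denotes the reduction of $f$ modulo $p$; elements of $\mathbb{Z}/(p)$ are represented by $\{0,\ldots,p-1\}$. $\mathrm{ord}_p$ is the $p$-adic valuation on $\mathbb{Z}$ (with $\mathrm{ord}_p(0)=+\infty$), and $s(f,\zeta_0):=\min_{i\geq 0}\left\{ i+\mathrm{ord}_p\frac{f^{(i)}(\zeta_0)}{i!}\right\}$, where $\frac{f^{(i)}(\zeta_0)}{i!}$ is the (integer) coefficient of $x^i$ in $f(x+\zeta_0)$. -}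

module Defs where

open import Data.Nat as ℕ using (ℕ; zero; suc)
open import Data.Nat.Divisibility as ℕD using (_∣?_)
open import Data.Integer as ℤ using (ℤ; +_; ∣_∣)
open import Data.Integer.Divisibility as ℤD using ()
open import Data.List using (List; []; _∷_; foldr; map; length; upTo)
open import Data.List.Relation.Unary.All using (All)
open import Data.Product using (∃; _×_)
open import Relation.Nullary using (¬_; yes; no)
open import Relation.Binary.PropositionalEquality using (_≡_)

-- Polynomials in ℤ[x] as coefficient lists, constant coefficient first.
Poly : Set
Poly = List ℤ

infixl 6 _+ₚ_ _-ₚ_
infixl 7 _*ₚ_

_+ₚ_ : Poly → Poly → Poly
[]      +ₚ g       = g
(a ∷ f) +ₚ []      = a ∷ f
(a ∷ f) +ₚ (b ∷ g) = (a ℤ.+ b) ∷ (f +ₚ g)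

negₚ : Poly → Poly
negₚ = map (λ c → ℤ.- c)

_-ₚ_ : Poly → Poly → Poly
f -ₚ g = f +ₚ negₚ g

scaleₚ : ℤ → Poly → Poly
scaleₚ c = map (c ℤ.*_)

_*ₚ_ : Poly → Poly → Poly
[]      *ₚ g = []
(a ∷ f) *ₚ g = scaleₚ a g +ₚ (+ 0 ∷ (f *ₚ g))

_^ₚ_ : Poly → ℕ → Poly
f ^ₚ zero  = + 1 ∷ []
f ^ₚ suc n = f *ₚ (f ^ₚ n)

eval : Poly → ℤ → ℤ
eval f a = foldr (λ c acc → c ℤ.+ a ℤ.* acc) (+ 0) f

-- the polynomial f(x + a)
shift : Poly → ℤ → Poly
shift f a = foldr (λ c acc → (c ∷ []) +ₚ ((a ∷ + 1 ∷ []) *ₚ acc)) [] f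

coeff : Poly → ℕ → ℤ
coeff []      _       = + 0
coeff (c ∷ f) zero    = c
coeff (c ∷ f) (suc i) = coeff f i

xMinus : ℤ → Poly
xMinus a = ℤ.- a ∷ + 1 ∷ []

IsZeroMod : ℕ → Poly → Set
IsZeroMod p f = All (λ c → (+ p) ℤD.∣ c) f

-- d̃ divides f̃ in (ℤ/p)[x]  (any g̃ lifts to some g ∈ ℤ[x])
DividesMod : ℕ → Poly → Poly → Set
DividesMod p d f = ∃ λ g → IsZeroMod p (f -ₚ d *ₚ g)

RootMultiplicity : ℕ → Poly → ℤ → ℕ → Set
RootMultiplicity p f ζ₀ j =
  DividesMod p (xMinus ζ₀ ^ₚ j) f × ¬ DividesMod p (xMinus ζ₀ ^ₚ suc j) f

data ℕ∞ : Set where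
  fin : ℕ → ℕ∞
  ∞   : ℕ∞

_+∞_ : ℕ → ℕ∞ → ℕ∞
m +∞ fin n = fin (m ℕ.+ n)
m +∞ ∞     = ∞

min∞ : ℕ∞ → ℕ∞ → ℕ∞
min∞ (fin m) (fin n) = fin (ℕ._⊓_ m n)
min∞ (fin m) ∞       = fin m
min∞ ∞       y       = y

-- p-adic valuation of a nonzero natural number n (fuel bounds the number
-- of divisions; fuel = n suffices when p ≥ 2 and n ≥ 1)
ordAux : ℕ → ℕ → ℕ → ℕ
ordAux zero       p n = 0
ordAux (suc fuel) p n with p ∣? n
... | yes pr = suc (ordAux fuel p (ℕD._∣_.quotient pr))
... | no  _  = 0

ord : ℕ → ℤ → ℕ∞
ord p c with ∣ c ∣
... | zero  = ∞
... | suc m = fin (ordAux (suc m) p (suc m))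

-- s(f, ζ0) = min_{i ≥ 0} { i + ord_p (coefficient of x^i in f(x+ζ0)) }.
-- Coefficients of index ≥ length f vanish (ord = ∞), so the minimum over
-- i < length f equals the minimum over all i ≥ 0.
s : ℕ → Poly → ℤ → ℕ∞
s p f ζ₀ = foldr min∞ ∞ (map (λ i → i +∞ ord p (coeff (shift f ζ₀) i)) (upTo (length f)))

module Submission where

-- Lemma 2.2.  Let A_i be the Taylor coefficients of f at ζ₀, i.e. the
-- coefficients of f(x + ζ₀) = shift f ζ₀, so that s(f, ζ₀) = min_i (i + ord_p A_i).
--   * (x - ζ₀)^n divides f̃ iff p divides A_0, ..., A_(n-1).  The exact root
--     multiplicity j therefore gives p ∣ A_i for i < j and p ∤ A_j; the term
--     i = j of the minimum is j itself, so s ≤ j.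
--   * Writing ζ = ζ₀ + y with p ∣ y, f(ζ) = A_0 + y·A_1 + y²·(...) ≡ 0 (mod p²)
--     and p ∣ A_1 (as j ≥ 2) force p² ∣ A_0.  So the terms i = 0, 1 are ≥ 2,
--     and every other term is ≥ i ≥ 2; hence s ≥ 2.
-- Polynomials are coefficient lists compared coefficientwise (LinComb).  The
-- main tool is that shift and right multiplication are Horner recursions and
-- therefore linear (HornerLinear); this yields shift((x - a)·q) = x·shift q,
-- hence the "only if" direction above, while the "if" direction goes through
-- synthetic division by x - a.

open import Defs
open import Data.Nat using (ℕ; _≤_; _<_; _^_)
open import Data.Nat.Primality using (Prime; prime⇒nonTrivial)
open import Data.Integer as ℤ using (+_)
open import Data.Integer.Divisibility as ℤD using ()
open import Data.Product using (∃; ∃₂; _×_; _,_)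
open import Relation.Nullary using (¬_; yes; no; contradiction)
open import Relation.Binary.PropositionalEquality
  using (_≡_; refl; sym; trans; cong; cong₂; subst; module ≡-Reasoning)

open import Data.Nat as ℕ
  using (zero; suc; z≤n; s≤s; z<s; s<s; _⊓_; NonTrivial; nonTrivial⇒nonZero; >-nonZero; >-nonZero⁻¹)
open import Data.Nat.Properties as ℕP using ()
open import Data.Nat.Divisibility as ℕD using (_∣_; _∣?_; quotient)
open import Data.Integer using (ℤ; ∣_∣; _+_; _*_; -_; _-_)
open import Data.Integer.Properties as ℤP using ()
open import Data.Integer.Divisibility.Signed as S using (divides)
open import Data.Integer.Tactic.RingSolver using (solve-∀)
open import Data.List using ([]; _∷_; [_]; drop; map; foldr; upTo; length)
open import Data.List.Relation.Unary.All as All using (All; []; _∷_)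
open import Data.List.Relation.Unary.All.Properties as AllP using ()
open import Data.List.Relation.Unary.Any using (here; there)
open import Data.List.Membership.Propositional using (_∈_)
open import Data.List.Membership.Propositional.Properties using (∈-map⁺; ∈-upTo⁺)
open import Data.Sum using (inj₁; inj₂)
open import Data.Unit using (⊤; tt)

-- h = u·f + v·g, coefficientwise (a record, so that u, f, v, g, h can be inferred).
record LinComb (u : ℤ) (f : Poly) (v : ℤ) (g : Poly) (h : Poly) : Set where
  constructor lin
  field coeffs : ∀ i → coeff h i ≡ u * coeff f i + v * coeff g i
open LinComb public

infixr 8 x·_
x·_ : Poly → Poly
x· h = + 0 ∷ h

coeff-drop1 : ∀ f i → coeff (drop 1 f) i ≡ coeff f (suc i)
coeff-drop1 []      i = refl
coeff-drop1 (c ∷ f) i = refl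

coeff-+ : ∀ f g i → coeff (f +ₚ g) i ≡ coeff f i + coeff g i
coeff-+ []      g       i       = sym (ℤP.+-identityˡ _)
coeff-+ (a ∷ f) []      i       = sym (ℤP.+-identityʳ _)
coeff-+ (a ∷ f) (b ∷ g) zero    = refl
coeff-+ (a ∷ f) (b ∷ g) (suc i) = coeff-+ f g i

coeff-neg : ∀ f i → coeff (negₚ f) i ≡ - coeff f i
coeff-neg []      i       = refl
coeff-neg (a ∷ f) zero    = refl
coeff-neg (a ∷ f) (suc i) = coeff-neg f i

coeff-- : ∀ f g i → coeff (f -ₚ g) i ≡ coeff f i - coeff g i
coeff-- f g i = trans (coeff-+ f (negₚ g) i) (cong (_+_ (coeff f i)) (coeff-neg g i))

coeff--lin : ∀ f g → LinComb (+ 1) f (- + 1) g (f -ₚ g)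
coeff--lin f g = lin λ i → trans (coeff-- f g i) (as-combination (coeff f i) (coeff g i))
  where
  as-combination : ∀ x y → x - y ≡ + 1 * x + - + 1 * y
  as-combination = solve-∀

coeff-reassemble : ∀ f g → LinComb (+ 1) (f -ₚ g) (+ 1) g f
coeff-reassemble f g = lin λ i → trans (reassemble (coeff f i) (coeff g i)) (cong (λ z → + 1 * z + + 1 * coeff g i) (sym (coeff-- f g i)))
  where
  reassemble : ∀ x y → x ≡ + 1 * (x - y) + + 1 * y
  reassemble = solve-∀

coeff-scale : ∀ c f i → coeff (scaleₚ c f) i ≡ c * coeff f i
coeff-scale c []      i       = sym (ℤP.*-zeroʳ c)
coeff-scale c (a ∷ f) zero    = refl
coeff-scale c (a ∷ f) (suc i) = coeff-scale c f i

coeff-const : ∀ c i → coeff [ c ] i ≡ c * coeff [ + 1 ] i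
coeff-const c zero    = sym (ℤP.*-identityʳ c)
coeff-const c (suc i) = sym (ℤP.*-zeroʳ c)

coeff-x·[] : ∀ i → coeff (x· []) i ≡ + 0
coeff-x·[] zero    = refl
coeff-x·[] (suc i) = refl

coeff-∷ : ∀ c f i → coeff (c ∷ f) i ≡ coeff [ c ] i + coeff (x· f) i
coeff-∷ c f zero    = sym (ℤP.+-identityʳ c)
coeff-∷ c f (suc i) = sym (ℤP.+-identityˡ _)

x·-lin : ∀ {u v f g h} → LinComb u f v g h → LinComb u (x· f) v (x· g) (x· h)
x·-lin {u} {v} {f} {g} {h} e = lin shifted
  where
  zero-lin : ∀ u v → + 0 ≡ u * + 0 + v * + 0
  zero-lin = solve-∀
  shifted : ∀ i → coeff (x· h) i ≡ u * coeff (x· f) i + v * coeff (x· g) i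
  shifted zero    = zero-lin u v
  shifted (suc i) = coeffs e i

coeff-*-∷ : ∀ c f k i → coeff ((c ∷ f) *ₚ k) i ≡ c * coeff k i + coeff (x· (f *ₚ k)) i
coeff-*-∷ c f k i = trans (coeff-+ (scaleₚ c k) (x· (f *ₚ k)) i) (cong (_+ _) (coeff-scale c k i))

coeff-linear-* : ∀ b d h → LinComb b h d (x· h) ((b ∷ d ∷ []) *ₚ h)
coeff-linear-* b d h = lin λ i → begin
  coeff ((b ∷ d ∷ []) *ₚ h) i                  ≡⟨ coeff-*-∷ b (d ∷ []) h i ⟩
  b * coeff h i + coeff (x· ((d ∷ []) *ₚ h)) i ≡⟨ cong (_+_ (b * coeff h i)) (coeffs (x·-lin dh) i) ⟩
  b * coeff h i + (d * coeff (x· h) i + + 0 * coeff (x· []) i)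
    ≡⟨ drop-zero (b * coeff h i) (d * coeff (x· h) i) (coeff (x· []) i) ⟩
  b * coeff h i + d * coeff (x· h) i ∎
  where
  open ≡-Reasoning
  drop-zero : ∀ x y z → x + (y + + 0 * z) ≡ x + y
  drop-zero = solve-∀
  dh : LinComb d h (+ 0) [] ((d ∷ []) *ₚ h)
  dh = lin λ i → trans (coeff-*-∷ d [] h i) (cong (_+_ (d * coeff h i)) (coeff-x·[] i))

coeff-xMinus-* : ∀ a h → LinComb (- a) h (+ 1) (x· h) (xMinus a *ₚ h)
coeff-xMinus-* a = coeff-linear-* (- a) (+ 1)

infix 4 _∣ᶜ_
_∣ᶜ_ : ℤ → Poly → Set
d ∣ᶜ h = ∀ i → d S.∣ coeff h i

lin-∣ᶜ : ∀ {d u v f g h} → d ∣ᶜ f → d ∣ᶜ g → LinComb u f v g h → d ∣ᶜ h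
lin-∣ᶜ {d} {u} {v} d∣f d∣g e i =
  subst (d S.∣_) (sym (coeffs e i)) (S.∣m∣n⇒∣m+n (S.∣n⇒∣m*n u (d∣f i)) (S.∣n⇒∣m*n v (d∣g i)))

∣-zero : ∀ {d x} → x ≡ + 0 → d S.∣ x
∣-zero {d} x≡0 = divides (+ 0) (trans x≡0 (sym (ℤP.*-zeroˡ d)))

x·-∣ᶜ : ∀ {d h} → d ∣ᶜ h → d ∣ᶜ x· h
x·-∣ᶜ d∣h zero    = ∣-zero refl
x·-∣ᶜ d∣h (suc i) = d∣h i

∣ᶜ⇒multiple : ∀ {d} f → d ∣ᶜ f → ∃ λ f' → LinComb d f' (+ 0) [] f
∣ᶜ⇒multiple {d} [] _ = [] , lin λ i → zero-comb d
  where
  zero-comb : ∀ d → + 0 ≡ d * + 0 + + 0 * + 0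
  zero-comb = solve-∀
∣ᶜ⇒multiple {d} (c ∷ f) d∣c∷f with ∣ᶜ⇒multiple f (λ i → d∣c∷f (suc i)) | d∣c∷f 0
... | f' , e | divides q c≡qd = q ∷ f' , lin coeffs-q∷f'
  where
  reorder : ∀ q d → q * d ≡ d * q + + 0 * + 0
  reorder = solve-∀
  coeffs-q∷f' : ∀ i → coeff (c ∷ f) i ≡ d * coeff (q ∷ f') i + + 0 * coeff [] i
  coeffs-q∷f' zero    = trans c≡qd (reorder q d)
  coeffs-q∷f' (suc i) = coeffs e i

IsZeroMod⇒∣ᶜ : ∀ {p f} → IsZeroMod p f → + p ∣ᶜ f
IsZeroMod⇒∣ᶜ []           i       = ∣-zero refl
IsZeroMod⇒∣ᶜ (p∣c ∷ p∣f) zero    = S.∣ᵤ⇒∣ p∣c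
IsZeroMod⇒∣ᶜ (p∣c ∷ p∣f) (suc i) = IsZeroMod⇒∣ᶜ p∣f i

∣ᶜ⇒IsZeroMod : ∀ {p} f → + p ∣ᶜ f → IsZeroMod p f
∣ᶜ⇒IsZeroMod []      p∣f = []
∣ᶜ⇒IsZeroMod (c ∷ f) p∣f = S.∣⇒∣ᵤ (p∣f 0) ∷ ∣ᶜ⇒IsZeroMod f (λ i → p∣f (suc i))

-- Both f ↦ shift f a and f ↦ f *ₚ k are defined by a Horner recursion
--   T [] = [],   T (c ∷ f) = c·B + M (T f)
-- with M linear.  Every such T is linear (on coefficient sequences, so in
-- particular it ignores trailing zeros), and hence preserves divisibility of
-- all coefficients.
module HornerLinear
  (B : Poly) (M : Poly → Poly) (T : Poly → Poly)
  (M-lin : ∀ {u v f g h} → LinComb u f v g h → LinComb u (M f) v (M g) (M h))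
  (T-[] : ∀ i → coeff (T []) i ≡ + 0)
  (T-∷ : ∀ c f i → coeff (T (c ∷ f)) i ≡ c * coeff B i + coeff (M (T f)) i)
  where

  open ≡-Reasoning

  view : ∀ f i → coeff (T f) i ≡ coeff f 0 * coeff B i + coeff (M (T (drop 1 f))) i
  view []      i = begin
    coeff (T []) i                                         ≡⟨ T-[] i ⟩
    + 0                                                    ≡⟨ vanish (coeff B i) (coeff (M []) i) ⟩
    + 0 * coeff B i + (+ 0 * coeff (M []) i + + 0 * coeff (M []) i)
      ≡⟨ cong (_+_ (+ 0 * coeff B i)) (sym (coeffs (M-lin T[]≈0) i)) ⟩
    + 0 * coeff B i + coeff (M (T [])) i                   ∎
    where
    vanish : ∀ x y → + 0 ≡ + 0 * x + (+ 0 * y + + 0 * y)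
    vanish = solve-∀
    T[]≈0 : LinComb (+ 0) [] (+ 0) [] (T [])
    T[]≈0 = lin λ i → trans (T-[] i) (vanish (+ 0) (+ 0))
  view (c ∷ f) i = T-∷ c f i

  tail-lin : ∀ {u v f g h} → LinComb u f v g h → LinComb u (drop 1 f) v (drop 1 g) (drop 1 h)
  tail-lin {u} {v} {f} {g} {h} e = lin λ i → begin
    coeff (drop 1 h) i                             ≡⟨ coeff-drop1 h i ⟩
    coeff h (suc i)                                ≡⟨ coeffs e (suc i) ⟩
    u * coeff f (suc i) + v * coeff g (suc i)
      ≡⟨ sym (cong₂ (λ x y → u * x + v * y) (coeff-drop1 f i) (coeff-drop1 g i)) ⟩
    u * coeff (drop 1 f) i + v * coeff (drop 1 g) i ∎

  step : ∀ {u v} f g h → LinComb u f v g h →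
         LinComb u (T (drop 1 f)) v (T (drop 1 g)) (T (drop 1 h)) → LinComb u (T f) v (T g) (T h)
  step {u} {v} f g h e ih = lin λ i → begin
    coeff (T h) i                                          ≡⟨ view h i ⟩
    coeff h 0 * coeff B i + coeff (M (T (drop 1 h))) i
      ≡⟨ cong₂ (λ x y → x * coeff B i + y) (coeffs e 0) (coeffs (M-lin ih) i) ⟩
    (u * coeff f 0 + v * coeff g 0) * coeff B i
      + (u * coeff (M (T (drop 1 f))) i + v * coeff (M (T (drop 1 g))) i)
      ≡⟨ distribute u v (coeff f 0) (coeff g 0) (coeff B i) _ _ ⟩
    u * (coeff f 0 * coeff B i + coeff (M (T (drop 1 f))) i)
      + v * (coeff g 0 * coeff B i + coeff (M (T (drop 1 g))) i)
      ≡⟨ sym (cong₂ (λ x y → u * x + v * y) (view f i) (view g i)) ⟩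
    u * coeff (T f) i + v * coeff (T g) i                  ∎
    where
    distribute : ∀ u v x y b X Y → (u * x + v * y) * b + (u * X + v * Y) ≡ u * (x * b + X) + v * (y * b + Y)
    distribute = solve-∀

  -- recursion on h, then f, then g (lexicographically)
  T-lin : ∀ {u v} f g h → LinComb u f v g h → LinComb u (T f) v (T g) (T h)
  T-lin f       g       (c ∷ h) e = step f g (c ∷ h) e (T-lin (drop 1 f) (drop 1 g) h (tail-lin e))
  T-lin (c ∷ f) g       []      e = step (c ∷ f) g [] e (T-lin f (drop 1 g) [] (tail-lin e))
  T-lin []      (d ∷ g) []      e = step [] (d ∷ g) [] e (T-lin [] g [] (tail-lin e))
  T-lin {u} {v} []      []      []      e = lin λ i →
    trans (T-[] i) (trans (vanish u v) (sym (cong₂ (λ x y → u * x + v * y) (T-[] i) (T-[] i))))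
    where
    vanish : ∀ u v → + 0 ≡ u * + 0 + v * + 0
    vanish = solve-∀

  T-∣ᶜ : ∀ {d} f → d ∣ᶜ f → d ∣ᶜ T f
  T-∣ᶜ {d} f d∣f i with ∣ᶜ⇒multiple f d∣f
  ... | f' , e = divides (coeff (T f') i) (trans (coeffs (T-lin f' [] f e) i) (factor d (coeff (T f') i) (coeff (T []) i)))
    where
    factor : ∀ d x y → d * x + + 0 * y ≡ x * d
    factor = solve-∀

linear-*-lin : ∀ b d {u v f g h} → LinComb u f v g h →
               LinComb u ((b ∷ d ∷ []) *ₚ f) v ((b ∷ d ∷ []) *ₚ g) ((b ∷ d ∷ []) *ₚ h)
linear-*-lin b d {u} {v} {f} {g} {h} e = lin λ i → begin
  coeff ((b ∷ d ∷ []) *ₚ h) i                  ≡⟨ coeffs (coeff-linear-* b d h) i ⟩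
  b * coeff h i + d * coeff (x· h) i           ≡⟨ cong₂ (λ x y → b * x + d * y) (coeffs e i) (coeffs (x·-lin e) i) ⟩
  b * (u * coeff f i + v * coeff g i) + d * (u * coeff (x· f) i + v * coeff (x· g) i)
    ≡⟨ regroup b d u v (coeff f i) (coeff g i) (coeff (x· f) i) (coeff (x· g) i) ⟩
  u * (b * coeff f i + d * coeff (x· f) i) + v * (b * coeff g i + d * coeff (x· g) i)
    ≡⟨ sym (cong₂ (λ x y → u * x + v * y) (coeffs (coeff-linear-* b d f) i) (coeffs (coeff-linear-* b d g) i)) ⟩
  u * coeff ((b ∷ d ∷ []) *ₚ f) i + v * coeff ((b ∷ d ∷ []) *ₚ g) i ∎
  where
  open ≡-Reasoning
  regroup : ∀ b d u v x y X Y → b * (u * x + v * y) + d * (u * X + v * Y) ≡ u * (b * x + d * X) + v * (b * y + d * Y)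
  regroup = solve-∀

module RightMultiplication (k : Poly) =
  HornerLinear k x·_ (_*ₚ k) x·-lin (λ _ → refl) (λ c f → coeff-*-∷ c f k)

*-assoc-linear : ∀ b d Q g → LinComb b (Q *ₚ g) d (x· (Q *ₚ g)) (((b ∷ d ∷ []) *ₚ Q) *ₚ g)
*-assoc-linear b d Q g = lin λ i → begin
  coeff (((b ∷ d ∷ []) *ₚ Q) *ₚ g) i             ≡⟨ coeffs (T-lin Q (x· Q) ((b ∷ d ∷ []) *ₚ Q) (coeff-linear-* b d Q)) i ⟩
  b * coeff (Q *ₚ g) i + d * coeff ((x· Q) *ₚ g) i ≡⟨ cong (λ y → b * coeff (Q *ₚ g) i + d * y) (coeff-*-∷ (+ 0) Q g i) ⟩
  b * coeff (Q *ₚ g) i + d * (+ 0 * coeff g i + coeff (x· (Q *ₚ g)) i)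
    ≡⟨ drop-zero b d (coeff (Q *ₚ g) i) (coeff g i) (coeff (x· (Q *ₚ g)) i) ⟩
  b * coeff (Q *ₚ g) i + d * coeff (x· (Q *ₚ g)) i ∎
  where
  open ≡-Reasoning
  open RightMultiplication g
  drop-zero : ∀ b d X G Y → b * X + d * (+ 0 * G + Y) ≡ b * X + d * Y
  drop-zero = solve-∀

eval-+ : ∀ f g y → eval (f +ₚ g) y ≡ eval f y + eval g y
eval-+ []      g       y = sym (ℤP.+-identityˡ _)
eval-+ (c ∷ f) []      y = sym (ℤP.+-identityʳ _)
eval-+ (c ∷ f) (d ∷ g) y = trans (cong (λ z → c + d + y * z) (eval-+ f g y)) (interchange c d y (eval f y) (eval g y))
  where
  interchange : ∀ c d y F G → c + d + y * (F + G) ≡ c + y * F + (d + y * G)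
  interchange = solve-∀

eval-scale : ∀ c f y → eval (scaleₚ c f) y ≡ c * eval f y
eval-scale c []      y = sym (ℤP.*-zeroʳ c)
eval-scale c (d ∷ f) y = trans (cong (λ z → c * d + y * z) (eval-scale c f y)) (factor c d y (eval f y))
  where
  factor : ∀ c d y F → c * d + y * (c * F) ≡ c * (d + y * F)
  factor = solve-∀

eval-* : ∀ f g y → eval (f *ₚ g) y ≡ eval f y * eval g y
eval-* []      g y = sym (ℤP.*-zeroˡ (eval g y))
eval-* (c ∷ f) g y = begin
  eval (scaleₚ c g +ₚ x· (f *ₚ g)) y        ≡⟨ eval-+ (scaleₚ c g) (x· (f *ₚ g)) y ⟩
  eval (scaleₚ c g) y + eval (x· (f *ₚ g)) y ≡⟨ cong₂ (λ u v → u + (+ 0 + y * v)) (eval-scale c g y) (eval-* f g y) ⟩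
  c * eval g y + (+ 0 + y * (eval f y * eval g y)) ≡⟨ factor c y (eval f y) (eval g y) ⟩
  (c + y * eval f y) * eval g y              ∎
  where
  open ≡-Reasoning
  factor : ∀ c y F G → c * G + (+ 0 + y * (F * G)) ≡ (c + y * F) * G
  factor = solve-∀

eval-second-order : ∀ h y → eval h y ≡ coeff h 0 + y * (coeff h 1 + y * eval (drop 2 h) y)
eval-second-order []          y = vanish y
  where
  vanish : ∀ y → + 0 ≡ + 0 + y * (+ 0 + y * + 0)
  vanish = solve-∀
eval-second-order (c ∷ [])    y = constant c y
  where
  constant : ∀ c y → c + y * + 0 ≡ c + y * (+ 0 + y * + 0)
  constant = solve-∀
eval-second-order (c ∷ d ∷ h) y = refl

constant-coefficient-∣ : ∀ {d} h y → d S.∣ y → d S.∣ coeff h 1 → d * d S.∣ eval h y → d * d S.∣ coeff h 0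
constant-coefficient-∣ {d} h y (divides t y≡td) (divides u h₁≡ud) (divides w hy≡wdd) =
  divides (w - t * u - t * t * R) (begin
    coeff h 0                                                   ≡⟨ isolate (coeff h 0) (y * (coeff h 1 + y * R)) ⟩
    coeff h 0 + y * (coeff h 1 + y * R) - y * (coeff h 1 + y * R) ≡⟨ cong (_- y * (coeff h 1 + y * R)) (sym (eval-second-order h y)) ⟩
    eval h y - y * (coeff h 1 + y * R)                          ≡⟨ cong₂ (λ e h₁ → e - y * (h₁ + y * R)) hy≡wdd h₁≡ud ⟩
    w * (d * d) - y * (u * d + y * R)                           ≡⟨ cong (λ z → w * (d * d) - z * (u * d + z * R)) y≡td ⟩
    w * (d * d) - t * d * (u * d + t * d * R)                   ≡⟨ factor w t u d R ⟩
    (w - t * u - t * t * R) * (d * d)                           ∎)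
  where
  open ≡-Reasoning
  R : ℤ
  R = eval (drop 2 h) y
  isolate : ∀ x z → x ≡ x + z - z
  isolate = solve-∀
  factor : ∀ w t u d R → w * (d * d) - t * d * (u * d + t * d * R) ≡ (w - t * u - t * t * R) * (d * d)
  factor = solve-∀

module ShiftAt (a : ℤ) where

  coeff-shift-∷ : ∀ c f i → coeff (shift (c ∷ f) a) i ≡ c * coeff [ + 1 ] i + coeff ((a ∷ + 1 ∷ []) *ₚ shift f a) i
  coeff-shift-∷ c f i = trans (coeff-+ [ c ] ((a ∷ + 1 ∷ []) *ₚ shift f a) i)
    (cong (_+ coeff ((a ∷ + 1 ∷ []) *ₚ shift f a) i) (coeff-const c i))

  open HornerLinear [ + 1 ] ((a ∷ + 1 ∷ []) *ₚ_) (λ f → shift f a) (linear-*-lin a (+ 1)) (λ _ → refl) coeff-shift-∷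
    public using () renaming (T-lin to shift-lin; T-∣ᶜ to shift-∣ᶜ)

  open ≡-Reasoning

  shift-root-factor : ∀ q h → LinComb (- a) q (+ 1) (x· q) h → ∀ i → coeff (shift h a) i ≡ coeff (x· shift q a) i
  shift-root-factor q h e i = begin
    coeff (shift h a) i                                      ≡⟨ coeffs (shift-lin q (x· q) h e) i ⟩
    - a * coeff (shift q a) i + + 1 * coeff (shift (x· q) a) i
      ≡⟨ cong (λ z → - a * coeff (shift q a) i + + 1 * z)
              (trans (coeff-shift-∷ (+ 0) q i) (cong (_+_ (+ 0 * coeff [ + 1 ] i)) (coeffs (coeff-linear-* a (+ 1) (shift q a)) i))) ⟩
    - a * coeff (shift q a) i + + 1 * (+ 0 * coeff [ + 1 ] i + (a * coeff (shift q a) i + + 1 * coeff (x· shift q a) i))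
      ≡⟨ cancel a (coeff (shift q a) i) (coeff [ + 1 ] i) (coeff (x· shift q a) i) ⟩
    coeff (x· shift q a) i                                   ∎
    where
    cancel : ∀ a X B Y → - a * X + + 1 * (+ 0 * B + (a * X + + 1 * Y)) ≡ Y
    cancel = solve-∀

  shift-const : ∀ r i → coeff (shift [ r ] a) i ≡ coeff [ r ] i
  shift-const r zero          = ℤP.+-identityʳ r
  shift-const r (suc zero)    = refl
  shift-const r (suc (suc i)) = refl

  shift-length : ∀ f i → length f ≤ i → coeff (shift f a) i ≡ + 0
  shift-length []      i       _         = refl
  shift-length (c ∷ f) (suc i) (ℕ.s≤s ℓ≤i) = begin
    coeff (shift (c ∷ f) a) (suc i)            ≡⟨ coeff-shift-∷ c f (suc i) ⟩
    c * + 0 + coeff ((a ∷ + 1 ∷ []) *ₚ shift f a) (suc i)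
      ≡⟨ cong (_+_ (c * + 0)) (coeffs (coeff-linear-* a (+ 1) (shift f a)) (suc i)) ⟩
    c * + 0 + (a * coeff (shift f a) (suc i) + + 1 * coeff (shift f a) i)
      ≡⟨ cong₂ (λ X Y → c * + 0 + (a * X + + 1 * Y)) (shift-length f (suc i) (ℕP.m≤n⇒m≤1+n ℓ≤i)) (shift-length f i ℓ≤i) ⟩
    c * + 0 + (a * + 0 + + 1 * + 0)            ≡⟨ vanish c a ⟩
    + 0                                        ∎
    where
    vanish : ∀ c a → c * + 0 + (a * + 0 + + 1 * + 0) ≡ + 0
    vanish = solve-∀

  eval-shift : ∀ f y → eval (shift f a) y ≡ eval f (a + y)
  eval-shift []      y = refl
  eval-shift (c ∷ f) y = begin
    eval ([ c ] +ₚ (a ∷ + 1 ∷ []) *ₚ shift f a) y                ≡⟨ eval-+ [ c ] ((a ∷ + 1 ∷ []) *ₚ shift f a) y ⟩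
    eval [ c ] y + eval ((a ∷ + 1 ∷ []) *ₚ shift f a) y          ≡⟨ cong (_+_ (eval [ c ] y)) (eval-* (a ∷ + 1 ∷ []) (shift f a) y) ⟩
    c + y * + 0 + (a + y * (+ 1 + y * + 0)) * eval (shift f a) y ≡⟨ cong (λ z → c + y * + 0 + (a + y * (+ 1 + y * + 0)) * z) (eval-shift f y) ⟩
    c + y * + 0 + (a + y * (+ 1 + y * + 0)) * eval f (a + y)     ≡⟨ collect c a y (eval f (a + y)) ⟩
    c + (a + y) * eval f (a + y)                                 ∎
    where
    collect : ∀ c a y F → c + y * + 0 + (a + y * (+ 1 + y * + 0)) * F ≡ c + (a + y) * F
    collect = solve-∀

synthetic-division : ∀ a f → ∃₂ λ q r → LinComb (+ 1) (xMinus a *ₚ q) (+ 1) [ r ] f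
synthetic-division a []      = [] , + 0 , lin λ where
  zero          → refl
  (suc zero)    → refl
  (suc (suc i)) → refl
synthetic-division a (c ∷ f) with synthetic-division a f
... | q , r , f≡ = r ∷ q , c + a * r , lin coeffs-c∷f
  where
  open ≡-Reasoning
  x-a : ∀ h → LinComb (- a) h (+ 1) (x· h) (xMinus a *ₚ h)
  x-a = coeff-xMinus-* a
  coeffs-c∷f : ∀ i → coeff (c ∷ f) i ≡ + 1 * coeff (xMinus a *ₚ (r ∷ q)) i + + 1 * coeff [ c + a * r ] i
  coeffs-c∷f zero    = begin
    c                                                    ≡⟨ constant c a r ⟩
    + 1 * (- a * r + + 1 * + 0) + + 1 * (c + a * r)
      ≡⟨ cong (λ z → + 1 * z + + 1 * (c + a * r)) (sym (coeffs (x-a (r ∷ q)) 0)) ⟩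
    + 1 * coeff (xMinus a *ₚ (r ∷ q)) 0 + + 1 * (c + a * r) ∎
    where
    constant : ∀ c a r → c ≡ + 1 * (- a * r + + 1 * + 0) + + 1 * (c + a * r)
    constant = solve-∀
  coeffs-c∷f (suc k) = begin
    coeff f k                                                ≡⟨ coeffs f≡ k ⟩
    + 1 * coeff (xMinus a *ₚ q) k + + 1 * coeff [ r ] k
      ≡⟨ cong (λ z → + 1 * z + + 1 * coeff [ r ] k) (coeffs (x-a q) k) ⟩
    + 1 * (- a * coeff q k + + 1 * coeff (x· q) k) + + 1 * coeff [ r ] k
      ≡⟨ regroup a (coeff q k) (coeff (x· q) k) (coeff [ r ] k) ⟩
    + 1 * (- a * coeff q k + + 1 * (coeff [ r ] k + coeff (x· q) k)) + + 1 * + 0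
      ≡⟨ cong (λ z → + 1 * (- a * coeff q k + + 1 * z) + + 1 * + 0) (sym (coeff-∷ r q k)) ⟩
    + 1 * (- a * coeff q k + + 1 * coeff (r ∷ q) k) + + 1 * + 0
      ≡⟨ cong (λ z → + 1 * z + + 1 * + 0) (sym (coeffs (x-a (r ∷ q)) (suc k))) ⟩
    + 1 * coeff (xMinus a *ₚ (r ∷ q)) (suc k) + + 1 * + 0  ∎
    where
    regroup : ∀ a Q X R → + 1 * (- a * Q + + 1 * X) + + 1 * R ≡ + 1 * (- a * Q + + 1 * (R + X)) + + 1 * + 0
    regroup = solve-∀

module TaylorAt (p : ℕ) (a : ℤ) where

  open ShiftAt a
  open ≡-Reasoning

  x-a·_ : ∀ h → LinComb (- a) h (+ 1) (x· h) (xMinus a *ₚ h)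
  x-a·_ = coeff-xMinus-* a

  shift-power-low : ∀ n g i → i < n → coeff (shift ((xMinus a ^ₚ n) *ₚ g) a) i ≡ + 0
  shift-power-low (suc n) g i i<1+n =
    trans (shift-root-factor (Pⁿg) ((xMinus a ^ₚ suc n) *ₚ g) (*-assoc-linear (- a) (+ 1) (xMinus a ^ₚ n) g) i)
          (below i i<1+n)
    where
    Pⁿg : Poly
    Pⁿg = (xMinus a ^ₚ n) *ₚ g
    below : ∀ i → i < suc n → coeff (x· shift Pⁿg a) i ≡ + 0
    below zero    _         = refl
    below (suc i) (s<s i<n) = shift-power-low n g i i<n

  power-divides⇒low-taylor : ∀ n f → DividesMod p (xMinus a ^ₚ n) f → ∀ i → i < n → + p S.∣ coeff (shift f a) i
  power-divides⇒low-taylor n f (g , p∣f-Pⁿg) i i<n =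
    subst (+ p S.∣_) (sym (coeffs (shift-lin (f -ₚ Pⁿg) Pⁿg f (coeff-reassemble f Pⁿg)) i))
      (S.∣m∣n⇒∣m+n (S.∣n⇒∣m*n (+ 1) (shift-∣ᶜ (f -ₚ Pⁿg) (IsZeroMod⇒∣ᶜ p∣f-Pⁿg) i))
                   (S.∣n⇒∣m*n (+ 1) (∣-zero (shift-power-low n g i i<n))))
    where
    Pⁿg : Poly
    Pⁿg = (xMinus a ^ₚ n) *ₚ g

  taylor-of-division : ∀ {f q r} → LinComb (+ 1) (xMinus a *ₚ q) (+ 1) [ r ] f →
                       ∀ i → coeff (shift f a) i ≡ coeff (x· shift q a) i + coeff [ r ] i
  taylor-of-division {f} {q} {r} f≡ i = begin
    coeff (shift f a) i                                                   ≡⟨ coeffs (shift-lin (xMinus a *ₚ q) [ r ] f f≡) i ⟩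
    + 1 * coeff (shift (xMinus a *ₚ q) a) i + + 1 * coeff (shift [ r ] a) i
      ≡⟨ cong₂ _+_ (ℤP.*-identityˡ (coeff (shift (xMinus a *ₚ q) a) i)) (ℤP.*-identityˡ (coeff (shift [ r ] a) i)) ⟩
    coeff (shift (xMinus a *ₚ q) a) i + coeff (shift [ r ] a) i
      ≡⟨ cong₂ _+_ (shift-root-factor q (xMinus a *ₚ q) (x-a· q) i) (shift-const r i) ⟩
    coeff (x· shift q a) i + coeff [ r ] i                               ∎

  lift-division : ∀ n f q r g → LinComb (+ 1) (xMinus a *ₚ q) (+ 1) [ r ] f → + p S.∣ r →
                  + p ∣ᶜ (q -ₚ (xMinus a ^ₚ n) *ₚ g) → + p ∣ᶜ (f -ₚ (xMinus a ^ₚ suc n) *ₚ g)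
  lift-division n f q r g f≡ p∣r p∣D = lin-∣ᶜ (lin-∣ᶜ p∣D (x·-∣ᶜ p∣D) (x-a· D)) p∣[r] E≡
    where
    G D E : Poly
    G = (xMinus a ^ₚ n) *ₚ g
    D = q -ₚ G
    E = f -ₚ (xMinus a ^ₚ suc n) *ₚ g
    p∣[r] : + p ∣ᶜ [ r ]
    p∣[r] zero    = p∣r
    p∣[r] (suc i) = ∣-zero refl
    regroup : ∀ a Q X R G Y →
      + 1 * (+ 1 * (- a * Q + + 1 * X) + + 1 * R) + - + 1 * (- a * G + + 1 * Y)
        ≡ + 1 * (- a * (+ 1 * Q + - + 1 * G) + + 1 * (+ 1 * X + - + 1 * Y)) + + 1 * R
    regroup = solve-∀
    E≡ : LinComb (+ 1) (xMinus a *ₚ D) (+ 1) [ r ] E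
    E≡ = lin λ i → begin
      coeff E i
        ≡⟨ coeffs (coeff--lin f ((xMinus a ^ₚ suc n) *ₚ g)) i ⟩
      + 1 * coeff f i + - + 1 * coeff ((xMinus a ^ₚ suc n) *ₚ g) i
        ≡⟨ cong₂ (λ x y → + 1 * x + - + 1 * y) (coeffs f≡ i) (coeffs (*-assoc-linear (- a) (+ 1) (xMinus a ^ₚ n) g) i) ⟩
      + 1 * (+ 1 * coeff (xMinus a *ₚ q) i + + 1 * coeff [ r ] i) + - + 1 * (- a * coeff G i + + 1 * coeff (x· G) i)
        ≡⟨ cong (λ z → + 1 * (+ 1 * z + + 1 * coeff [ r ] i) + - + 1 * (- a * coeff G i + + 1 * coeff (x· G) i)) (coeffs (x-a· q) i) ⟩
      + 1 * (+ 1 * (- a * coeff q i + + 1 * coeff (x· q) i) + + 1 * coeff [ r ] i) + - + 1 * (- a * coeff G i + + 1 * coeff (x· G) i)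
        ≡⟨ regroup a (coeff q i) (coeff (x· q) i) (coeff [ r ] i) (coeff G i) (coeff (x· G) i) ⟩
      + 1 * (- a * (+ 1 * coeff q i + - + 1 * coeff G i) + + 1 * (+ 1 * coeff (x· q) i + - + 1 * coeff (x· G) i)) + + 1 * coeff [ r ] i
        ≡⟨ sym (cong₂ (λ x y → + 1 * (- a * x + + 1 * y) + + 1 * coeff [ r ] i) (coeffs (coeff--lin q G) i) (coeffs (x·-lin (coeff--lin q G)) i)) ⟩
      + 1 * (- a * coeff D i + + 1 * coeff (x· D) i) + + 1 * coeff [ r ] i
        ≡⟨ sym (cong (λ z → + 1 * z + + 1 * coeff [ r ] i) (coeffs (x-a· D) i)) ⟩
      + 1 * coeff (xMinus a *ₚ D) i + + 1 * coeff [ r ] i ∎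

  low-taylor⇒power-divides : ∀ n f → (∀ i → i < n → + p S.∣ coeff (shift f a) i) → DividesMod p (xMinus a ^ₚ n) f
  low-taylor⇒power-divides zero    f _   = f , ∣ᶜ⇒IsZeroMod (f -ₚ [ + 1 ] *ₚ f) (λ i → ∣-zero (f-f≡0 i))
    where
    cancel : ∀ x → x - (+ 1 * x + + 0) ≡ + 0
    cancel = solve-∀
    f-f≡0 : ∀ i → coeff (f -ₚ [ + 1 ] *ₚ f) i ≡ + 0
    f-f≡0 i = trans (coeff-- f ([ + 1 ] *ₚ f) i)
      (trans (cong (_-_ (coeff f i)) (trans (coeff-*-∷ (+ 1) [] f i) (cong (_+_ (+ 1 * coeff f i)) (coeff-x·[] i))))
             (cancel (coeff f i)))
  low-taylor⇒power-divides (suc n) f low = from-division (synthetic-division a f)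
    where
    from-division : (∃₂ λ q r → LinComb (+ 1) (xMinus a *ₚ q) (+ 1) [ r ] f) → DividesMod p (xMinus a ^ₚ suc n) f
    from-division (q , r , f≡) with low-taylor⇒power-divides n q low-q
      where
      low-q : ∀ i → i < n → + p S.∣ coeff (shift q a) i
      low-q i i<n = subst (+ p S.∣_) (trans (taylor-of-division f≡ (suc i)) (ℤP.+-identityʳ _)) (low (suc i) (s<s i<n))
    ... | g , p∣q-Pⁿg = g , ∣ᶜ⇒IsZeroMod _ (lift-division n f q r g f≡ p∣r (IsZeroMod⇒∣ᶜ p∣q-Pⁿg))
      where
      p∣r : + p S.∣ r
      p∣r = subst (+ p S.∣_) (trans (taylor-of-division f≡ 0) (ℤP.+-identityˡ r)) (low 0 z<s)

infix 4 _≤∞_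
_≤∞_ : ℕ → ℕ∞ → Set
n ≤∞ fin m = n ≤ m
n ≤∞ ∞     = ⊤

≤∞-weaken : ∀ {n m} x → n ≤ m → m ≤∞ x → n ≤∞ x
≤∞-weaken (fin k) n≤m m≤k = ℕP.≤-trans n≤m m≤k
≤∞-weaken ∞       _   _   = tt

+∞-mono : ∀ i {k} x → k ≤∞ x → i ℕ.+ k ≤∞ i +∞ x
+∞-mono i (fin m) k≤m = ℕP.+-monoʳ-≤ i k≤m
+∞-mono i ∞       _   = tt

+∞-≥ : ∀ i x → i ≤∞ i +∞ x
+∞-≥ i (fin m) = ℕP.m≤m+n i m
+∞-≥ i ∞       = tt

ordAux-≥ : ∀ {p} .{{_ : NonTrivial p}} k fuel n → 0 < n → n ≤ fuel → p ^ k ∣ n → k ≤ ordAux fuel p n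
ordAux-≥         zero    fuel       n _   _        _      = z≤n
ordAux-≥         (suc k) zero       n 0<n n≤0      _      = contradiction (ℕP.<-≤-trans 0<n n≤0) λ ()
ordAux-≥ {p} (suc k) (suc fuel) n 0<n n≤1+fuel pᵏ⁺¹∣n with p ∣? n
... | no  p∤n = contradiction (ℕD.∣-trans (ℕD.m∣m*n (p ^ k)) pᵏ⁺¹∣n) p∤n
... | yes p∣n = s≤s (ordAux-≥ k fuel (quotient p∣n) 0<q q≤fuel pᵏ∣q)
  where
  instance
    n≢0 : ℕ.NonZero n
    n≢0 = >-nonZero 0<n
  0<q : 0 < quotient p∣n
  0<q = >-nonZero⁻¹ (quotient p∣n) {{ℕD.quotient≢0 p∣n}}
  q≤fuel : quotient p∣n ≤ fuel
  q≤fuel = ℕP.≤-pred (ℕP.≤-trans (ℕD.quotient-< p∣n) n≤1+fuel)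
  pᵏ∣q : p ^ k ∣ quotient p∣n
  pᵏ∣q = ℕD.*-cancelˡ-∣ p {{nonTrivial⇒nonZero p}} (subst (p ^ suc k ∣_) (ℕD.m∣n⇒n≡m*quotient p∣n) pᵏ⁺¹∣n)

ord-≥ : ∀ {p} .{{_ : NonTrivial p}} k c → + (p ^ k) ℤD.∣ c → k ≤∞ ord p c
ord-≥ k c pᵏ∣c with ∣ c ∣ | pᵏ∣c
... | zero  | _      = tt
... | suc m | pᵏ∣1+m = ordAux-≥ k (suc m) (suc m) z<s ℕP.≤-refl pᵏ∣1+m

ord-zero : ∀ p c → ¬ (+ p ℤD.∣ c) → ord p c ≡ fin 0
ord-zero p c p∤c with ∣ c ∣ | p∤c
... | zero  | p∤0   = contradiction (ℕD._∣0 p) p∤0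
... | suc m | p∤1+m with p ∣? suc m
...   | yes p∣1+m = contradiction p∣1+m p∤1+m
...   | no  _     = refl

min∞-≥ : ∀ {b} x y → b ≤∞ x → b ≤∞ y → b ≤∞ min∞ x y
min∞-≥ (fin m) (fin n) b≤m b≤n = ℕP.⊓-glb b≤m b≤n
min∞-≥ (fin m) ∞       b≤m _   = b≤m
min∞-≥ ∞       y       _   b≤y = b≤y

minimum-≥ : ∀ {b} L → All (b ≤∞_) L → b ≤∞ foldr min∞ ∞ L
minimum-≥ []      []          = tt
minimum-≥ (x ∷ L) (b≤x ∷ b≤L) = min∞-≥ x (foldr min∞ ∞ L) b≤x (minimum-≥ L b≤L)

minimum-≤ : ∀ {n} L → fin n ∈ L → ∃ λ m → foldr min∞ ∞ L ≡ fin m × m ≤ n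
minimum-≤ {n} (x ∷ L) (here refl) with foldr min∞ ∞ L
... | fin r = n ⊓ r , refl , ℕP.m⊓n≤m n r
... | ∞     = n , refl , ℕP.≤-refl
minimum-≤ {n} (x ∷ L) (there n∈L) with minimum-≤ L n∈L
... | m , min≡m , m≤n rewrite min≡m with x
...   | fin r = r ⊓ m , refl , ℕP.≤-trans (ℕP.m⊓n≤n r m) m≤n
...   | ∞     = m , refl , m≤n

between : ∀ {b c} x → b ≤∞ x → (∃ λ m → x ≡ fin m × m ≤ c) → ∃ λ m → x ≡ fin m × b ≤ m × m ≤ c
between (fin m) b≤m (.m , refl , m≤c) = m , refl , b≤m , m≤c

square-∣ᵤ⇒∣ : ∀ p x → + (p ℕ.* p) ℤD.∣ x → + p * + p S.∣ x
square-∣ᵤ⇒∣ p x p²∣x = subst (S._∣ x) (ℤP.pos-* p p) (S.∣ᵤ⇒∣ p²∣x)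

square-∣⇒∣ᵤ : ∀ p x → + p * + p S.∣ x → + (p ^ 2) ℤD.∣ x
square-∣⇒∣ᵤ p x p²∣x = subst (ℤD._∣ x) (cong +_ (cong (p ℕ.*_) (sym (ℕP.*-identityʳ p)))) (S.∣⇒∣ᵤ (subst (S._∣ x) (sym (ℤP.pos-* p p)) p²∣x))

module TaylorValuation (p : ℕ) (f : Poly) (a : ℤ) where

  open ShiftAt a

  A : ℕ → ℤ
  A i = coeff (shift f a) i

  term : ℕ → ℕ∞
  term i = i +∞ ord p (A i)

  s-≥2 : .{{_ : NonTrivial p}} → + p * + p S.∣ A 0 → + p S.∣ A 1 → 2 ≤∞ s p f a
  s-≥2 p²∣A₀ p∣A₁ = minimum-≥ _ (AllP.map⁺ (All.universal term-≥2 (upTo (length f))))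
    where
    term-≥2 : ∀ i → 2 ≤∞ term i
    term-≥2 zero          = +∞-mono 0 (ord p (A 0)) (ord-≥ 2 (A 0) (square-∣⇒∣ᵤ p (A 0) p²∣A₀))
    term-≥2 (suc zero)    = +∞-mono 1 (ord p (A 1)) (ord-≥ 1 (A 1) (subst (ℤD._∣ A 1) (cong +_ (sym (ℕP.*-identityʳ p))) (S.∣⇒∣ᵤ p∣A₁)))
    term-≥2 (suc (suc i)) = ≤∞-weaken (term (2 ℕ.+ i)) (s≤s (s≤s z≤n)) (+∞-≥ (2 ℕ.+ i) (ord p (A (2 ℕ.+ i))))

  s-≤ : ∀ j → ¬ (+ p S.∣ A j) → ∃ λ m → s p f a ≡ fin m × m ≤ j
  s-≤ j p∤Aⱼ with minimum-≤ (map term (upTo (length f))) (subst (_∈ map term (upTo (length f))) termⱼ≡j termⱼ∈)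
    where
    j<length : j < length f
    j<length with length f ℕP.≤? j
    ... | yes length≤j = contradiction (∣-zero (shift-length f j length≤j)) p∤Aⱼ
    ... | no  length≰j = ℕP.≰⇒> length≰j
    termⱼ∈ : term j ∈ map term (upTo (length f))
    termⱼ∈ = ∈-map⁺ term (∈-upTo⁺ j<length)
    termⱼ≡j : term j ≡ fin (j ℕ.+ 0)
    termⱼ≡j = cong (j +∞_) (ord-zero p (A j) (λ p∣Aⱼ → p∤Aⱼ (S.∣ᵤ⇒∣ p∣Aⱼ)))
  ... | m , s≡m , m≤j+0 = m , s≡m , subst (m ≤_) (ℕP.+-identityʳ j) m≤j+0

square∣power : ∀ p {k} → 2 ≤ k → p ℕ.* p ℕD.∣ p ^ k
square∣power p {suc (suc k)} (s≤s (s≤s _)) = ℕD.divides (p ^ k) (trans (sym (ℕP.*-assoc p p (p ^ k))) (ℕP.*-comm (p ℕ.* p) (p ^ k)))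

below-suc : ∀ {P : ℕ → Set} {n} → (∀ i → i < n → P i) → P n → ∀ i → i < suc n → P i
below-suc {n = n} below at i i<1+n with ℕP.m<1+n⇒m<n∨m≡n i<1+n
... | inj₁ i<n  = below i i<n
... | inj₂ refl = at

-- Lemma 2.2: 2 ≤ s(f, ζ₀) ≤ j.
lemma2p2 : (p k : ℕ) → Prime p → 2 ≤ k → (f : Poly) → ¬ IsZeroMod p f →
    (ζ₀ : ℕ) → ζ₀ < p → (j : ℕ) → 2 ≤ j → RootMultiplicity p f (+ ζ₀) j →
    (∃ λ (ζ : ℕ) → ζ < p ^ k × (+ p) ℤD.∣ (+ ζ ℤ.- + ζ₀) × (+ (p ^ k)) ℤD.∣ eval f (+ ζ)) →
    ∃ λ (m : ℕ) → s p f (+ ζ₀) ≡ fin m × 2 ≤ m × m ≤ j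
lemma2p2 p k p-prime 2≤k f _ ζ₀ _ j 2≤j (xʲ∣f , xʲ⁺¹∤f) (ζ , _ , p∣y , pᵏ∣fζ) =
  between (s p f a) (s-≥2 p²∣A₀ (p∣A 1 2≤j)) (s-≤ j p∤Aⱼ)
  where
  instance
    p-nontrivial : NonTrivial p
    p-nontrivial = prime⇒nonTrivial p-prime
  a y : ℤ
  a = + ζ₀
  y = + ζ - + ζ₀
  open TaylorAt p a
  open TaylorValuation p f a
  open ShiftAt a using (eval-shift)
  p∣A : ∀ i → i < j → + p S.∣ A i
  p∣A = power-divides⇒low-taylor j f xʲ∣f
  p∤Aⱼ : ¬ (+ p S.∣ A j)
  p∤Aⱼ p∣Aⱼ = xʲ⁺¹∤f (low-taylor⇒power-divides (suc j) f (below-suc p∣A p∣Aⱼ))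
  f-at-ζ : eval (shift f a) y ≡ eval f (+ ζ)
  f-at-ζ = trans (eval-shift f y) (cong (eval f) (a+[z-a]≡z a (+ ζ)))
    where
    a+[z-a]≡z : ∀ a z → a + (z - a) ≡ z
    a+[z-a]≡z = solve-∀
  p²∣A₀ : + p * + p S.∣ A 0
  p²∣A₀ = constant-coefficient-∣ (shift f a) y (S.∣ᵤ⇒∣ p∣y) (p∣A 1 2≤j)
            (subst (+ p * + p S.∣_) (sym f-at-ζ) (square-∣ᵤ⇒∣ p (eval f (+ ζ)) (ℕD.∣-trans (square∣power p 2≤k) pᵏ∣fζ)))
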